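{- Let $n,a,b,e$ be integers with $e>0$ and $a=2b+e$, and suppose $n=\mathrm{Even}\bigl(\tfrac{2b}{e}\bigr)$. Let $P_{n+1}$ be the path with vertices $v_0,\dots,v_n$ and edges $v_iv_{i+1}$ ($0\le i\le n-1$). Let $L$ be a $1$-reduced list of $P_{n+1}$, that is, $L$ assigns to each $v_i$ a finite set $L(i)\subset\mathbb{N}$ such that $|L(0)|=b$, $|L(i)|=a$ for all $i\in\{1,\dots,n-2\}$, $|L(n-1)|=|L(n)|=b+e$, and $|L(n-1)\cup L(n)|\ge 2b$. Then $P_{n+1}$ is $(L,b)$-choosable: there exist sets $c(i)\subset L(i)$ with $|c(i)|=b$ for all $i$ and $c(i)\cap c(i+1)=\emptyset$ for all $i\in\{0,\dots,n-1\}$.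
   Context: $\mathrm{Even}(x)$ denotes the smallest even integer $p$ with $p\ge x$. For a graph $G$, a list $L$ is a map $V(G)\to\mathcal{P}(\mathbb{N})$; $G$ is $(L,b)$-choosable if one can choose for each vertex $v$ a subset $c(v)\subset L(v)$ of size $b$ such that adjacent vertices receive disjoint subsets. -}

module Defs where

open import Data.Nat using (ℕ; _+_; _*_; _∸_; _≤_; _<_)
open import Data.Nat.Properties using (_≟_)
open import Data.Nat.Divisibility using (_∣_)
open import Relation.Binary.PropositionalEquality using (_≡_)
open import Data.Product using (_×_; Σ)
open import Data.List using (List; length; _++_; deduplicate)
open import Data.List.Relation.Unary.All using (All)
open import Data.List.Relation.Unary.Unique.Propositional using (Unique)
open import Data.List.Membership.Propositional using (_∈_)
open import Data.List.Relation.Binary.Disjoint.Propositional using (Disjoint)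

-- IsEvenCeil n num den : n = Even(num/den), the smallest even integer p with p ≥ num/den
-- (den > 0, num ≥ 0, so the minimum is a natural number; comparisons cleared of denominators).
IsEvenCeil : ℕ → ℕ → ℕ → Set
IsEvenCeil n num den =
  2 ∣ n × num ≤ n * den × (∀ p → 2 ∣ p → num ≤ p * den → n ≤ p)

-- A finite subset of ℕ is represented by a duplicate-free list.
FinSet : Set
FinSet = List ℕ

∣_∣ : FinSet → ℕ
∣ s ∣ = length s

_∪_ : FinSet → FinSet → FinSet
s ∪ t = deduplicate _≟_ (s ++ t)

_⊆_ : FinSet → FinSet → Set
s ⊆ t = All (_∈ t) s

OneReduced : ℕ → ℕ → ℕ → ℕ → (ℕ → FinSet) → Set
OneReduced n a b e L =
  (∀ i → i ≤ n → Unique (L i)) ×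
  ∣ L 0 ∣ ≡ b ×
  (∀ i → 1 ≤ i → i + 2 ≤ n → ∣ L i ∣ ≡ a) ×
  ∣ L (n ∸ 1) ∣ ≡ b + e ×
  ∣ L n ∣ ≡ b + e ×
  2 * b ≤ ∣ L (n ∸ 1) ∪ L n ∣

PathChoosable : ℕ → (ℕ → FinSet) → ℕ → Set
PathChoosable n L b =
  Σ (ℕ → FinSet) λ c →
    (∀ i → i ≤ n → Unique (c i) × c i ⊆ L i × ∣ c i ∣ ≡ b) ×
    (∀ i → i < n → Disjoint (c i) (c (i + 1)))

-- Choose the sets backwards, from v_n down to v_0. Put B_0 = ∅ and B_{i+1} = L(i) ∖ B_i, and
-- call c(i) constrained when it meets B_i in at most k_i colours, where k_0 = 0 and
-- k_{i+1} = |B_{i+1}| + k_i − b. Given a constrained c(i+1), pick c(i) in L(i) ∖ c(i+1), taking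
-- colours outside B_i first: c(i+1) uses at most k_{i+1} colours of B_{i+1} = L(i) ∖ B_i, which
-- leaves at least b − k_i of them, and c(i) is again constrained. As |L(i)| = 2b + e at interior
-- vertices, k grows by e every two steps, so k_{n−2} and k_{n−1} are at least (n/2 − 1)e ≥ b − e.
-- This slack lets us start with a c(n) ⊆ L(n) that takes colours outside L(n−1) first and
-- colours of L(n−1) ∖ B_{n−1} last, after which c(n−1) can still be chosen.

module Submission where

open import Defs
open import Data.Nat using (ℕ; _+_; _*_; _<_)
open import Relation.Binary.PropositionalEquality using (_≡_)

open import Data.Nat using (zero; suc; _∸_; _⊓_; _≤_; z≤n; s≤s; s≤s⁻¹; _≤?_)
open import Data.Nat.Properties
open import Data.Nat.Divisibility using (divides)
open import Data.Nat.Tactic.RingSolver using (solve-∀)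
open import Data.List using ([]; _∷_; length; _++_; filter; take)
open import Data.List.Properties using (length-++; length-take; length-filter; filter-notAll; filter-reject; filter-accept; filter-all; ++-assoc)
open import Data.List.Relation.Unary.All as All using (All; []; _∷_)
open import Data.List.Relation.Unary.Any as Any using (here)
open import Data.List.Relation.Unary.AllPairs using (_∷_)
open import Data.List.Relation.Unary.Unique.Propositional using (Unique)
import Data.List.Relation.Unary.Unique.Propositional.Properties as Unique
import Data.List.Relation.Unary.Unique.DecPropositional.Properties as DecUnique
open import Data.List.Membership.Propositional using (_∈_; _∉_)
open import Data.List.Membership.Propositional.Properties using (∈-filter⁻; ∈-filter⁺; ∈-++⁻; ∈-++⁺ˡ; ∈-++⁺ʳ; ∈-deduplicate⁻)
open import Data.List.Membership.DecPropositional _≟_ using (_∈?_; _∉?_)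
open import Data.List.Relation.Binary.Disjoint.Propositional using (Disjoint)
open import Data.List.Relation.Binary.Sublist.Propositional.Properties using (Any-resp-⊆; take-⊆)
open import Data.Product using (Σ; _×_; _,_; proj₁; proj₂; uncurry)
open import Data.Sum using (inj₁; inj₂)
open import Function using (_∘_; id)
open import Relation.Binary.PropositionalEquality using (_≢_; refl; sym; trans; cong; subst; subst₂; module ≡-Reasoning)
open import Relation.Nullary using (yes; no; contradiction)

infixl 7 _∩_
infixl 6 _∖_

_∩_ : FinSet → FinSet → FinSet
xs ∩ ys = filter (_∈? ys) xs

_∖_ : FinSet → FinSet → FinSet
xs ∖ ys = filter (_∉? ys) xs

∈-∩⁻ : ∀ {x} xs ys → x ∈ xs ∩ ys → x ∈ xs × x ∈ ys
∈-∩⁻ xs ys = ∈-filter⁻ (_∈? ys) {xs = xs}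

∈-∖⁻ : ∀ {x} xs ys → x ∈ xs ∖ ys → x ∈ xs × x ∉ ys
∈-∖⁻ xs ys = ∈-filter⁻ (_∉? ys) {xs = xs}

∩-unique : ∀ {xs} ys → Unique xs → Unique (xs ∩ ys)
∩-unique ys = Unique.filter⁺ (_∈? ys)

∖-unique : ∀ {xs} ys → Unique xs → Unique (xs ∖ ys)
∖-unique ys = Unique.filter⁺ (_∉? ys)

∖-[] : ∀ xs → xs ∖ [] ≡ xs
∖-[] xs = filter-all (_∉? []) (All.tabulate λ _ ())

∖-∖-comm : ∀ xs ys zs → xs ∖ ys ∖ zs ≡ xs ∖ zs ∖ ys
∖-∖-comm [] ys zs = refl
∖-∖-comm (x ∷ xs) ys zs with x ∈? ys | x ∈? zs
... | yes _ | yes _ = ∖-∖-comm xs ys zs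
... | yes p | no _  = trans (∖-∖-comm xs ys zs) (sym (filter-reject (_∉? ys) (λ x∉ys → x∉ys p)))
... | no _  | yes q = trans (filter-reject (_∉? zs) (λ x∉zs → x∉zs q)) (∖-∖-comm xs ys zs)
... | no p  | no q  = trans (filter-accept (_∉? zs) q)
                        (trans (cong (x ∷_) (∖-∖-comm xs ys zs)) (sym (filter-accept (_∉? ys) p)))

length-∩+∖ : ∀ xs ys → length (xs ∩ ys) + length (xs ∖ ys) ≡ length xs
length-∩+∖ [] ys = refl
length-∩+∖ (x ∷ xs) ys with x ∈? ys
... | yes _ = cong suc (length-∩+∖ xs ys)
... | no _  = trans (+-suc _ _) (cong suc (length-∩+∖ xs ys))

length-mono-⊆ : ∀ {xs ys} → Unique xs → xs ⊆ ys → length xs ≤ length ys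
length-mono-⊆ {[]} _ _ = z≤n
length-mono-⊆ {x ∷ xs} {ys} (x∉xs ∷ !xs) (x∈ys ∷ xs⊆ys) = begin-strict
  length xs                  ≤⟨ length-mono-⊆ !xs (All.zipWith (uncurry miss) (x∉xs , xs⊆ys)) ⟩
  length (ys ∖ (x ∷ []))     <⟨ filter-notAll (_∉? (x ∷ [])) ys (Any.map (λ x≡y y∉x → y∉x (here (sym x≡y))) x∈ys) ⟩
  length ys                  ∎
  where
  open ≤-Reasoning
  miss : ∀ {y} → x ≢ y → y ∈ ys → y ∈ ys ∖ (x ∷ [])
  miss x≢y y∈ys = ∈-filter⁺ (_∉? (x ∷ [])) y∈ys λ { (here y≡x) → x≢y (sym y≡x) }

length-∩-≤ : ∀ {xs} ys → Unique xs → length (xs ∩ ys) ≤ length ys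
length-∩-≤ {xs} ys !xs = length-mono-⊆ (∩-unique ys !xs) (All.tabulate (proj₂ ∘ ∈-∩⁻ xs ys))

length-∩-comm : ∀ {xs ys} → Unique xs → Unique ys → length (xs ∩ ys) ≡ length (ys ∩ xs)
length-∩-comm !xs !ys = ≤-antisym (∩-≤ !xs) (∩-≤ !ys)
  where
  ∩-≤ : ∀ {xs ys} → Unique xs → length (xs ∩ ys) ≤ length (ys ∩ xs)
  ∩-≤ {xs} {ys} !xs = length-mono-⊆ (∩-unique ys !xs) (All.tabulate λ x∈ →
    let (x∈xs , x∈ys) = ∈-∩⁻ xs ys x∈ in ∈-filter⁺ (_∈? xs) x∈ys x∈xs)

length-≤-∖ : ∀ {xs} ys → Unique xs → length xs ≤ length ys + length (xs ∖ ys)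
length-≤-∖ {xs} ys !xs = begin
  length xs                             ≡⟨ sym (length-∩+∖ xs ys) ⟩
  length (xs ∩ ys) + length (xs ∖ ys)   ≤⟨ +-monoˡ-≤ _ (length-∩-≤ ys !xs) ⟩
  length ys + length (xs ∖ ys)          ∎
  where open ≤-Reasoning

length-∪-≤ : ∀ xs ys → length (xs ∪ ys) ≤ length xs + length (ys ∖ xs)
length-∪-≤ xs ys = begin
  length (xs ∪ ys)             ≤⟨ length-mono-⊆ (DecUnique.deduplicate-! _≟_ (xs ++ ys)) (All.tabulate split) ⟩
  length (xs ++ ys ∖ xs)       ≡⟨ length-++ xs ⟩
  length xs + length (ys ∖ xs) ∎
  where
  open ≤-Reasoning
  split : ∀ {x} → x ∈ xs ∪ ys → x ∈ xs ++ ys ∖ xs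
  split {x} x∈ with ∈-++⁻ xs (∈-deduplicate⁻ _≟_ (xs ++ ys) x∈) | x ∈? xs
  ... | _        | yes x∈xs = ∈-++⁺ˡ x∈xs
  ... | inj₁ x∈xs | no x∉xs = ∈-++⁺ˡ x∈xs
  ... | inj₂ x∈ys | no x∉xs = ∈-++⁺ʳ xs (∈-filter⁺ (_∉? xs) x∈ys x∉xs)

outsideFirst : FinSet → FinSet → FinSet
outsideFirst S M = M ∖ S ++ M ∩ S

outsideFirst-unique : ∀ S {M} → Unique M → Unique (outsideFirst S M)
outsideFirst-unique S {M} !M = Unique.++⁺ (∖-unique S !M) (∩-unique S !M)
  λ (x∈M∖S , x∈M∩S) → proj₂ (∈-∖⁻ M S x∈M∖S) (proj₂ (∈-∩⁻ M S x∈M∩S))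

∈-outsideFirst⁻ : ∀ S M {x} → x ∈ outsideFirst S M → x ∈ M
∈-outsideFirst⁻ S M x∈ with ∈-++⁻ (M ∖ S) x∈
... | inj₁ x∈M∖S = proj₁ (∈-∖⁻ M S x∈M∖S)
... | inj₂ x∈M∩S = proj₁ (∈-∩⁻ M S x∈M∩S)

length-outsideFirst : ∀ S M → length (outsideFirst S M) ≡ length M
length-outsideFirst S M = begin
  length (M ∖ S ++ M ∩ S)            ≡⟨ length-++ (M ∖ S) ⟩
  length (M ∖ S) + length (M ∩ S)    ≡⟨ +-comm (length (M ∖ S)) _ ⟩
  length (M ∩ S) + length (M ∖ S)    ≡⟨ length-∩+∖ M S ⟩
  length M                           ∎
  where open ≡-Reasoning

∈-take⁻ : ∀ {x} n (xs : FinSet) → x ∈ take n xs → x ∈ xs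
∈-take⁻ n xs = Any-resp-⊆ (take-⊆ n xs)

length-take-≤ : ∀ {n} (xs : FinSet) → n ≤ length xs → length (take n xs) ≡ n
length-take-≤ {n} xs n≤ = trans (length-take n xs) (m≤n⇒m⊓n≡m n≤)

length-take-++-∩ : ∀ n xs ys S → All (_∉ S) xs → length (take n (xs ++ ys) ∩ S) ≤ n ∸ length xs
length-take-++-∩ n [] ys S [] = begin
  length (take n ys ∩ S)  ≤⟨ length-filter (_∈? S) (take n ys) ⟩
  length (take n ys)      ≡⟨ length-take n ys ⟩
  n ⊓ length ys           ≤⟨ m⊓n≤m n _ ⟩
  n                       ∎
  where open ≤-Reasoning
length-take-++-∩ zero (x ∷ xs) ys S _ = z≤n
length-take-++-∩ (suc n) (x ∷ xs) ys S (x∉S ∷ xs∉S)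
  rewrite filter-reject (_∈? S) {xs = take n (xs ++ ys)} x∉S = length-take-++-∩ n xs ys S xs∉S

module PathColouring {A : Set} (_#_ : A → A → Set) where

  Proper : (ℕ → A → Set) → ℕ → (ℕ → A) → Set
  Proper Admissible n c = (∀ i → i ≤ n → Admissible i (c i)) × (∀ i → i < n → c i # c (i + 1))

  Proper-map : ∀ {P Q : ℕ → A → Set} {n c} → (∀ {i x} → P i x → Q i x) → Proper P n c → Proper Q n c
  Proper-map P⇒Q (admissible , adjacent) = (λ i i≤n → P⇒Q (admissible i i≤n)) , adjacent

  snoc : ℕ → (ℕ → A) → A → ℕ → A
  snoc n c d i with i ≤? n
  ... | yes _ = c i
  ... | no _  = d

  snoc-≤ : ∀ n c d {i} → i ≤ n → snoc n c d i ≡ c i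
  snoc-≤ n c d {i} i≤n with i ≤? n
  ... | yes _  = refl
  ... | no i≰n = contradiction i≤n i≰n

  snoc-suc : ∀ n c d → snoc n c d (suc n) ≡ d
  snoc-suc n c d with suc n ≤? n
  ... | yes n<n = contradiction n<n (n≮n n)
  ... | no _    = refl

  extend : ∀ {Admissible : ℕ → A → Set} {n c d} →
           Proper Admissible n c → Admissible (suc n) d → c n # d → Proper Admissible (suc n) (snoc n c d)
  extend {Admissible} {n} {c} {d} (admissible , adjacent) ad cn#d = admissible′ , adjacent′
    where
    admissible′ : ∀ i → i ≤ suc n → Admissible i (snoc n c d i)
    admissible′ i i≤1+n with m≤n⇒m<n∨m≡n i≤1+n
    ... | inj₁ i<1+n = subst (Admissible i) (sym (snoc-≤ n c d (s≤s⁻¹ i<1+n))) (admissible i (s≤s⁻¹ i<1+n))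
    ... | inj₂ refl  = subst (Admissible (suc n)) (sym (snoc-suc n c d)) ad
    adjacent′ : ∀ i → i < suc n → snoc n c d i # snoc n c d (i + 1)
    adjacent′ i i<1+n with m≤n⇒m<n∨m≡n (s≤s⁻¹ i<1+n)
    ... | inj₁ i<n = subst₂ _#_ (sym (snoc-≤ n c d (<⇒≤ i<n))) (sym (snoc-≤ n c d (subst (_≤ n) (+-comm 1 i) i<n))) (adjacent i i<n)
    ... | inj₂ refl = subst₂ _#_ (sym (snoc-≤ n c d ≤-refl)) (sym (trans (cong (snoc n c d) (+-comm n 1)) (snoc-suc n c d))) cn#d

  descend : ∀ {Admissible : ℕ → A → Set} n →
            (∀ i → i < n → ∀ d → Admissible (suc i) d → Σ A λ c → Admissible i c × c # d) →
            ∀ d → Admissible n d → Σ (ℕ → A) λ c → Proper Admissible n c × c n ≡ d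
  descend zero step d ad = (λ _ → d) , ((λ { zero _ → ad }) , λ _ ()) , refl
  descend {Admissible} (suc n) step d ad =
    let (c , ac , c#d) = step n ≤-refl d ad
        (col , proper , col-n≡c) = descend {Admissible} n (λ i i<n → step i (m<n⇒m<1+n i<n)) c ac
    in snoc n col d , extend {Admissible} proper ad (subst (_# d) (sym col-n≡c) c#d) , snoc-suc n col d

module Alternating (L : ℕ → FinSet) (b : ℕ) where

  B : ℕ → FinSet
  B zero    = []
  B (suc i) = L i ∖ B i

  k : ℕ → ℕ
  k zero    = 0
  k (suc i) = length (B (suc i)) + k i ∸ b

  room : ℕ → ℕ
  room i = length (B (suc i)) + k i

  Fits : ℕ → FinSet → Set
  Fits i c = Unique c × c ⊆ L i × length c ≡ b

  Constrained : ℕ → FinSet → Set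
  Constrained i c = Fits i c × length (c ∩ B i) ≤ k i

  k-suc+b : ∀ {i} → b ≤ room i → k (suc i) + b ≡ room i
  k-suc+b = m∸n+n≡m

  room-zero : length (L 0) ≡ b → room 0 ≡ b
  room-zero len = trans (+-identityʳ _) (trans (cong length (∖-[] (L 0))) len)

  room-suc : ∀ {i e} → Unique (L (suc i)) → length (L (suc i)) ≡ 2 * b + e → b ≤ room i →
             b + e + k i ≤ room (suc i)
  room-suc {i} {e} !L len b≤room = +-cancelʳ-≤ b _ _ (begin
    b + e + k i + b                                        ≡⟨ +-double b e (k i) ⟩
    2 * b + e + k i                                        ≡⟨ cong (_+ k i) (sym len) ⟩
    length (L (suc i)) + k i                               ≤⟨ +-monoˡ-≤ (k i) (length-≤-∖ (B (suc i)) !L) ⟩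
    length (B (suc i)) + length (B (suc (suc i))) + k i    ≡⟨ +-swap (length (B (suc i))) _ (k i) ⟩
    length (B (suc (suc i))) + room i                      ≡⟨ cong (length (B (suc (suc i))) +_) (sym (k-suc+b b≤room)) ⟩
    length (B (suc (suc i))) + (k (suc i) + b)             ≡⟨ sym (+-assoc _ (k (suc i)) b) ⟩
    room (suc i) + b                                       ∎)
    where
    open ≤-Reasoning
    +-double : ∀ b e κ → b + e + κ + b ≡ 2 * b + e + κ
    +-double = solve-∀
    +-swap : ∀ x y κ → x + y + κ ≡ y + (x + κ)
    +-swap = solve-∀

  enough-preferred : ∀ {i d} → Unique (L i) → Unique d → b ≤ room i → length (d ∩ B (suc i)) ≤ k (suc i) →
              b ≤ length (B (suc i) ∖ d) + k i
  enough-preferred {i} {d} !L !d b≤room count = +-cancelˡ-≤ (length (Bᵢ₊₁ ∩ d)) _ _ (begin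
    length (Bᵢ₊₁ ∩ d) + b                             ≤⟨ +-monoˡ-≤ b (subst (_≤ k (suc i)) (length-∩-comm !d !Bᵢ₊₁) count) ⟩
    k (suc i) + b                                     ≡⟨ k-suc+b b≤room ⟩
    length Bᵢ₊₁ + k i                                 ≡⟨ cong (_+ k i) (sym (length-∩+∖ Bᵢ₊₁ d)) ⟩
    length (Bᵢ₊₁ ∩ d) + length (Bᵢ₊₁ ∖ d) + k i       ≡⟨ +-assoc (length (Bᵢ₊₁ ∩ d)) _ _ ⟩
    length (Bᵢ₊₁ ∩ d) + (length (Bᵢ₊₁ ∖ d) + k i)     ∎)
    where
    open ≤-Reasoning
    Bᵢ₊₁ : FinSet
    Bᵢ₊₁ = B (suc i)
    !Bᵢ₊₁ : Unique Bᵢ₊₁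
    !Bᵢ₊₁ = ∖-unique (B i) !L

  step-back : ∀ {i d} → Unique (L i) → b ≤ length (L i ∖ d) → b ≤ length (B (suc i) ∖ d) + k i →
              Σ FinSet λ c → Constrained i c × Disjoint c d
  step-back {i} {d} !L b≤free b≤preferred = c , ((!c , c⊆L , |c|≡b) , count) , c#d
    where
    M c : FinSet
    M = L i ∖ d
    c = take b (outsideFirst (B i) M)
    !c : Unique c
    !c = Unique.take⁺ b (outsideFirst-unique (B i) (∖-unique d !L))
    c⊆M : ∀ {x} → x ∈ c → x ∈ M
    c⊆M = ∈-outsideFirst⁻ (B i) M ∘ ∈-take⁻ b (outsideFirst (B i) M)
    c⊆L : c ⊆ L i
    c⊆L = All.tabulate (proj₁ ∘ ∈-∖⁻ (L i) d ∘ c⊆M)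
    |c|≡b : length c ≡ b
    |c|≡b = length-take-≤ _ (subst (b ≤_) (sym (length-outsideFirst (B i) M)) b≤free)
    count : length (c ∩ B i) ≤ k i
    count = ≤-trans (length-take-++-∩ b (M ∖ B i) (M ∩ B i) (B i) (All.tabulate (proj₂ ∘ ∈-∖⁻ M (B i))))
                    (m≤n+o⇒m∸n≤o b _ (subst (λ X → b ≤ length X + k i) (∖-∖-comm (L i) (B i) d) b≤preferred))
    c#d : Disjoint c d
    c#d (x∈c , x∈d) = proj₂ (∈-∖⁻ (L i) d (c⊆M x∈c)) x∈d

∸-+-≤ : ∀ {x z m} b → x ≤ z → b ≤ m → x ≤ m → b ∸ z + x ≤ m
∸-+-≤ {x} {z} {m} b x≤z b≤m x≤m with b ≤? z
... | yes b≤z = subst (_≤ m) (cong (_+ x) (sym (m≤n⇒m∸n≡0 b≤z))) x≤m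
... | no b≰z  = ≤-trans (+-monoʳ-≤ (b ∸ z) x≤z) (subst (_≤ m) (sym (m∸n+n≡m (<⇒≤ (≰⇒> b≰z)))) b≤m)

-- P and R are the lists of v_{n−1} and v_n; X and K play the roles of B_{n−1} and k_{n−1}.
module LastPair {P R X : FinSet} {b e K : ℕ} (!P : Unique P) (!R : Unique R)
  (|P| : length P ≡ b + e) (|R| : length R ≡ b + e) (|P∪R| : 2 * b ≤ length (P ∪ R))
  (|P∩X| : length (P ∩ X) ≤ K + e) (b≤K+e : b ≤ K + e) where

  Z Y S T c : FinSet
  Z = R ∖ P
  Y = R ∩ P
  S = P ∖ X
  T = Z ++ outsideFirst S Y
  c = take b T

  Z∌P : All (_∉ P) Z
  Z∌P = All.tabulate (proj₂ ∘ ∈-∖⁻ R P)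

  T⊆R : ∀ {x} → x ∈ T → x ∈ R
  T⊆R x∈T with ∈-++⁻ Z x∈T
  ... | inj₁ x∈Z = proj₁ (∈-∖⁻ R P x∈Z)
  ... | inj₂ x∈Y = proj₁ (∈-∩⁻ R P (∈-outsideFirst⁻ S Y x∈Y))

  !T : Unique T
  !T = Unique.++⁺ (∖-unique P !R) (outsideFirst-unique S (∩-unique P !R))
    λ (x∈Z , x∈Y) → proj₂ (∈-∖⁻ R P x∈Z) (proj₂ (∈-∩⁻ R P (∈-outsideFirst⁻ S Y x∈Y)))

  |Z|+|Y| : length Z + length Y ≡ b + e
  |Z|+|Y| = trans (+-comm (length Z) _) (trans (length-∩+∖ R P) |R|)

  |T| : length T ≡ b + e
  |T| = trans (length-++ Z) (trans (cong (length Z +_) (length-outsideFirst S Y)) |Z|+|Y|)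

  c-fits : Unique c × c ⊆ R × length c ≡ b
  c-fits = Unique.take⁺ b !T , All.tabulate (T⊆R ∘ ∈-take⁻ b T) ,
           length-take-≤ T (subst (b ≤_) (sym |T|) (m≤m+n b e))

  b≤|Z|+e : b ≤ length Z + e
  b≤|Z|+e = +-cancelˡ-≤ b _ _ (begin
    b + b                  ≡⟨ cong (b +_) (sym (+-identityʳ b)) ⟩
    2 * b                  ≤⟨ |P∪R| ⟩
    length (P ∪ R)         ≤⟨ length-∪-≤ P R ⟩
    length P + length Z    ≡⟨ cong (_+ length Z) |P| ⟩
    b + e + length Z       ≡⟨ +-assoc b e _ ⟩
    b + (e + length Z)     ≡⟨ cong (b +_) (+-comm e _) ⟩
    b + (length Z + e)     ∎)
    where open ≤-Reasoning

  b≤|P∖c| : b ≤ length (P ∖ c)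
  b≤|P∖c| = +-cancelʳ-≤ e _ _ (begin
    b + e                             ≡⟨ sym |P| ⟩
    length P                          ≡⟨ sym (length-∩+∖ P c) ⟩
    length (P ∩ c) + length (P ∖ c)   ≡⟨ cong (_+ length (P ∖ c)) (length-∩-comm !P (proj₁ c-fits)) ⟩
    length (c ∩ P) + length (P ∖ c)   ≤⟨ +-monoˡ-≤ _ |c∩P| ⟩
    e + length (P ∖ c)                ≡⟨ +-comm e _ ⟩
    length (P ∖ c) + e                ∎)
    where
    open ≤-Reasoning
    |c∩P| : length (c ∩ P) ≤ e
    |c∩P| = ≤-trans (length-take-++-∩ b Z (outsideFirst S Y) P Z∌P) (m≤n+o⇒m∸n≤o b _ b≤|Z|+e)

  prefix : FinSet
  prefix = Z ++ Y ∖ S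

  prefix∌S : All (_∉ S) prefix
  prefix∌S = All.tabulate avoid
    where
    avoid : ∀ {x} → x ∈ prefix → x ∉ S
    avoid x∈ x∈S with ∈-++⁻ Z x∈
    ... | inj₁ x∈Z   = All.lookup Z∌P x∈Z (proj₁ (∈-∖⁻ P X x∈S))
    ... | inj₂ x∈Y∖S = proj₂ (∈-∖⁻ Y S x∈Y∖S) x∈S

  |c∩S| : length (c ∩ S) ≤ b ∸ length prefix
  |c∩S| = subst (λ xs → length (take b xs ∩ S) ≤ b ∸ length prefix) (++-assoc Z (Y ∖ S) (Y ∩ S))
                (length-take-++-∩ b prefix (Y ∩ S) S prefix∌S)

  |P∩X|≤|prefix| : length (P ∩ X) ≤ length prefix
  |P∩X|≤|prefix| = +-cancelʳ-≤ (length S) _ _ (begin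
    length (P ∩ X) + length S                        ≡⟨ trans (length-∩+∖ P X) |P| ⟩
    b + e                                            ≡⟨ sym |Z|+|Y| ⟩
    length Z + length Y                              ≡⟨ cong (length Z +_) (trans (sym (length-∩+∖ Y S)) (+-comm (length (Y ∩ S)) _)) ⟩
    length Z + (length (Y ∖ S) + length (Y ∩ S))     ≡⟨ sym (+-assoc (length Z) _ _) ⟩
    length Z + length (Y ∖ S) + length (Y ∩ S)       ≡⟨ cong (_+ length (Y ∩ S)) (sym (length-++ Z)) ⟩
    length prefix + length (Y ∩ S)                   ≤⟨ +-monoʳ-≤ (length prefix) (length-∩-≤ S (∩-unique P !R)) ⟩
    length prefix + length S                         ∎)
    where open ≤-Reasoning

  b≤|S∖c|+K : b ≤ length (S ∖ c) + K
  b≤|S∖c|+K = +-cancelʳ-≤ e _ _ (begin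
    b + e                                              ≡⟨ sym (trans (length-∩+∖ P X) |P|) ⟩
    length (P ∩ X) + length S                          ≡⟨ cong (length (P ∩ X) +_) (sym (length-∩+∖ S c)) ⟩
    length (P ∩ X) + (length (S ∩ c) + length (S ∖ c)) ≡⟨ cong (λ n → length (P ∩ X) + (n + length (S ∖ c))) (length-∩-comm (∖-unique X !P) (proj₁ c-fits)) ⟩
    length (P ∩ X) + (length (c ∩ S) + length (S ∖ c)) ≡⟨ +-rotate (length (P ∩ X)) (length (c ∩ S)) (length (S ∖ c)) ⟩
    length (S ∖ c) + (length (c ∩ S) + length (P ∩ X)) ≤⟨ +-monoʳ-≤ (length (S ∖ c)) |c∩S|+|P∩X| ⟩
    length (S ∖ c) + (K + e)                           ≡⟨ sym (+-assoc (length (S ∖ c)) K e) ⟩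
    length (S ∖ c) + K + e                             ∎)
    where
    open ≤-Reasoning
    +-rotate : ∀ x y z → x + (y + z) ≡ z + (y + x)
    +-rotate = solve-∀
    |c∩S|+|P∩X| : length (c ∩ S) + length (P ∩ X) ≤ K + e
    |c∩S|+|P∩X| = ≤-trans (+-monoˡ-≤ (length (P ∩ X)) |c∩S|) (∸-+-≤ b |P∩X|≤|prefix| b≤K+e |P∩X|)

module Path (L : ℕ → FinSet) (b e t : ℕ) (reduced : OneReduced (suc (suc t)) (2 * b + e) b e L) where
  open Alternating L b
  open PathColouring {FinSet} Disjoint

  !L : ∀ i → i ≤ suc (suc t) → Unique (L i)
  !L = proj₁ reduced

  !L≤t : ∀ {i} → i ≤ t → Unique (L i)
  !L≤t i≤t = !L _ (m≤n⇒m≤1+n (m≤n⇒m≤1+n i≤t))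

  |L-interior| : ∀ {i} → 1 ≤ i → i ≤ t → length (L i) ≡ 2 * b + e
  |L-interior| {i} 1≤i i≤t = proj₁ (proj₂ (proj₂ reduced)) i 1≤i (subst (i + 2 ≤_) (+-comm t 2) (+-monoˡ-≤ 2 i≤t))

  P R : FinSet
  P = L (suc t)
  R = L (suc (suc t))

  !P : Unique P
  !P = !L (suc t) (n≤1+n _)

  !R : Unique R
  !R = !L (suc (suc t)) ≤-refl

  |P| : length P ≡ b + e
  |P| = proj₁ (proj₂ (proj₂ (proj₂ reduced)))

  |R| : length R ≡ b + e
  |R| = proj₁ (proj₂ (proj₂ (proj₂ (proj₂ reduced))))

  |P∪R| : 2 * b ≤ length (P ∪ R)
  |P∪R| = proj₂ (proj₂ (proj₂ (proj₂ (proj₂ reduced))))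

  room-lower : ∀ i → i ≤ t → b ≤ room i
  room-lower zero    _   = ≤-reflexive (sym (room-zero (proj₁ (proj₂ reduced))))
  room-lower (suc i) i<t = ≤-trans (≤-trans (m≤m+n b e) (m≤m+n (b + e) (k i)))
    (room-suc (!L≤t i<t) (|L-interior| (s≤s z≤n) i<t) (room-lower i (<⇒≤ i<t)))

  k-growth : ∀ {i} → suc i ≤ t → e + k i ≤ k (suc (suc i))
  k-growth {i} i<t = subst (_≤ k (suc (suc i))) (trans (cong (_∸ b) (+-assoc b e (k i))) (m+n∸m≡n b (e + k i)))
    (∸-monoˡ-≤ b (room-suc (!L≤t i<t) (|L-interior| (s≤s z≤n) i<t) (room-lower i (<⇒≤ i<t))))

  k-lower : ∀ j → j * 2 ≤ t → j * e ≤ k (j * 2) × j * e ≤ k (suc (j * 2))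
  k-lower zero    _ = z≤n , z≤n
  k-lower (suc j) h = ≤-trans (+-monoʳ-≤ e even) (k-growth 1+2j≤t) , ≤-trans (+-monoʳ-≤ e odd) (k-growth h)
    where
    1+2j≤t : suc (j * 2) ≤ t
    1+2j≤t = ≤-trans (n≤1+n _) h
    even : j * e ≤ k (j * 2)
    even = proj₁ (k-lower j (≤-trans (n≤1+n _) 1+2j≤t))
    odd : j * e ≤ k (suc (j * 2))
    odd = proj₂ (k-lower j (≤-trans (n≤1+n _) 1+2j≤t))

  enough-free : ∀ i → i ≤ t → ∀ {d} → length d ≡ b → b ≤ length (B (suc i) ∖ d) + k i → b ≤ length (L i ∖ d)
  enough-free zero    _   {d} _   b≤preferred = subst (λ xs → b ≤ length (xs ∖ d)) (∖-[] (L 0)) (subst (b ≤_) (+-identityʳ _) b≤preferred)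
  enough-free (suc i) i<t {d} |d| _      = +-cancelˡ-≤ b _ _ (begin
    b + b                  ≡⟨ cong (b +_) (sym (+-identityʳ b)) ⟩
    2 * b                  ≤⟨ m≤m+n (2 * b) e ⟩
    2 * b + e              ≡⟨ sym (|L-interior| (s≤s z≤n) i<t) ⟩
    length (L (suc i))     ≤⟨ length-≤-∖ d (!L≤t i<t) ⟩
    length d + length (L (suc i) ∖ d) ≡⟨ cong (_+ _) |d| ⟩
    b + length (L (suc i) ∖ d) ∎)
    where open ≤-Reasoning

  descent-step : ∀ i → i < suc t → ∀ d → Constrained (suc i) d → Σ FinSet λ c → Constrained i c × Disjoint c d
  descent-step i i<1+t d ((!d , _ , |d|) , count) = step-back (!L≤t i≤t) (enough-free i i≤t |d| b≤preferred) b≤preferred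
    where
    i≤t : i ≤ t
    i≤t = s≤s⁻¹ i<1+t
    b≤preferred : b ≤ length (B (suc i) ∖ d) + k i
    b≤preferred = enough-preferred (!L≤t i≤t) !d (room-lower i i≤t) count

  colour-from-top : ∀ {d} → Fits (suc (suc t)) d → b ≤ length (P ∖ d) → b ≤ length (P ∖ B (suc t) ∖ d) + k (suc t) →
                    PathChoosable (suc (suc t)) L b
  colour-from-top {d} fits b≤free b≤preferred with step-back !P b≤free b≤preferred
  ... | c , constrained , c#d with descend {Constrained} (suc t) descent-step c constrained
  ... | col , proper , refl = snoc (suc t) col d , extend {Fits} (Proper-map {Constrained} {Fits} proj₁ proper) fits c#d

  choosable : b ≤ e + k t → b ≤ e + k (suc t) → PathChoosable (suc (suc t)) L b
  choosable b≤e+kt b≤e+K = colour-from-top Top.c-fits Top.b≤|P∖c| Top.b≤|S∖c|+K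
    where
    |X|≤K+e : length (B (suc t)) ≤ k (suc t) + e
    |X|≤K+e = +-cancelʳ-≤ (k t) _ _ (begin
      length (B (suc t)) + k t     ≡⟨ sym (k-suc+b (room-lower t ≤-refl)) ⟩
      k (suc t) + b                ≤⟨ +-monoʳ-≤ (k (suc t)) b≤e+kt ⟩
      k (suc t) + (e + k t)        ≡⟨ sym (+-assoc (k (suc t)) e (k t)) ⟩
      k (suc t) + e + k t          ∎)
      where open ≤-Reasoning
    module Top = LastPair !P !R |P| |R| |P∪R|
      (≤-trans (length-∩-≤ (B (suc t)) !P) |X|≤K+e) (subst (b ≤_) (+-comm e _) b≤e+K)

theorem2p2 : (n a b e : ℕ) → 0 < e → a ≡ 2 * b + e → IsEvenCeil n (2 * b) e →
             (L : ℕ → FinSet) → OneReduced n a b e L → PathChoosable n L b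
theorem2p2 _ _ b e _ refl (divides zero refl , _) L (!L , |L0| , _) =
  (λ _ → L 0) , (λ { zero _ → !L 0 z≤n , All.tabulate id , |L0| }) , λ _ ()
theorem2p2 _ _ b e _ refl (divides (suc m) refl , 2b≤[m+1]2e , _) L reduced =
  choosable (bound (proj₁ (k-lower m ≤-refl))) (bound (proj₂ (k-lower m ≤-refl)))
  where
  open Path L b e (m * 2) reduced
  reassoc : ∀ q e → q * 2 * e ≡ 2 * (q * e)
  reassoc = solve-∀
  b≤[m+1]e : b ≤ suc m * e
  b≤[m+1]e = *-cancelˡ-≤ 2 (subst (2 * b ≤_) (reassoc (suc m) e) 2b≤[m+1]2e)
  bound : ∀ {x} → m * e ≤ x → b ≤ e + x
  bound m*e≤x = ≤-trans b≤[m+1]e (+-monoʳ-≤ e m*e≤x)
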